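{- Let $\Gamma$ be a $PT$-graph of type 2(c), in which the two cycles of $\Gamma_P$ have lengths $p$ and $q$, the vertices $u_1,u_2$ belong to the $p$-cycle and the vertices $v_1,v_2$ belong to the $q$-cycle. Then a $(0,1,-1)$-matrix corresponding to $\Gamma$ has finite multiplicative order if and only if at least one of $d_P(u_1,u_2)$ and $d_P(v_1,v_2)$ is a multiple of $\gcd(p,q)$.
   Context: A $PT$-graph of type 2(c) is a 2-arc-coloured digraph whose arcs are: blue arcs $\Gamma_P$ forming two vertex-disjoint directed cycles, of lengths $p$ and $q$, covering all vertices; and four further arcs, red arcs $(u_1,v_1)$, $(u_2,v_2)$ and blue arcs $(u_1,v_2)$, $(u_2,v_1)$, where $u_1,u_2$ are distinct vertices of the $p$-cycle and $v_1,v_2$ are distinct vertices of the $q$-cycle. Given an ordering $w_1,\dots,w_n$ of the vertices, the corresponding $(0,1,-1)$-matrix $A$ has $A_{ij}=1$ if $(w_i,w_j)$ is a blue arc, $-1$ if it is a red arc, $0$ otherwise. $d_P(u,v)$ denotes the length of the directed path from $u$ to $v$ along the cycle of $\Gamma_P$ containing both. -}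

module Defs where

open import Data.Nat as ℕ using (ℕ; zero; suc; _∸_; _≡ᵇ_; _≤ᵇ_)
open import Data.Fin using (Fin; toℕ; _≟_) renaming (zero to fzero; suc to fsuc)
open import Data.Product using (Σ; _×_)
open import Relation.Binary.PropositionalEquality using (_≡_)
open import Data.Sum using (_⊎_; inj₁; inj₂)
open import Data.Bool using (Bool; true; false; if_then_else_; _∧_)
open import Data.Integer using (ℤ; +_; -_; _+_; _*_)
open import Relation.Nullary using (does)

Matrix : ℕ → Set
Matrix n = Fin n → Fin n → ℤ

sumℤ : ∀ {n} → (Fin n → ℤ) → ℤ
sumℤ {zero}  f = + 0
sumℤ {suc n} f = f fzero + sumℤ (λ k → f (fsuc k))

_⊗_ : ∀ {n} → Matrix n → Matrix n → Matrix n
(A ⊗ B) i j = sumℤ (λ k → A i k * B k j)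

I : ∀ {n} → Matrix n
I i j = if does (i ≟ j) then + 1 else + 0

_^ᴹ_ : ∀ {n} → Matrix n → ℕ → Matrix n
A ^ᴹ zero  = I
A ^ᴹ suc k = A ⊗ (A ^ᴹ k)

HasFiniteOrder : ∀ {n} → Matrix n → Set
HasFiniteOrder {n} A = Σ ℕ λ k → (1 ℕ.≤ k) × (∀ i j → (A ^ᴹ k) i j ≡ I i j)

-- Vertices of Γ: the p-cycle (Fin p) and the q-cycle (Fin q).
Vertex : ℕ → ℕ → Set
Vertex p q = Fin p ⊎ Fin q

-- blue arc i → i+1 (mod m) of the directed m-cycle on Fin m
cycArc : ∀ {m} → Fin m → Fin m → ℤ
cycArc {m} i j =
  if suc (toℕ i) ≡ᵇ m
  then (if toℕ j ≡ᵇ 0 then + 1 else + 0)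
  else (if toℕ j ≡ᵇ suc (toℕ i) then + 1 else + 0)

_==_ : ∀ {m} → Fin m → Fin m → Bool
i == j = does (i ≟ j)

-- Arc weight of the PT-graph of type 2(c): +1 blue, -1 red, 0 no arc.
-- Red arcs (u₁,v₁),(u₂,v₂); blue arcs (u₁,v₂),(u₂,v₁); plus the two blue cycles.
ptWeight : ∀ {p q} → (u₁ u₂ : Fin p) → (v₁ v₂ : Fin q) →
           Vertex p q → Vertex p q → ℤ
ptWeight u₁ u₂ v₁ v₂ (inj₁ i) (inj₁ j) = cycArc i j
ptWeight u₁ u₂ v₁ v₂ (inj₂ i) (inj₂ j) = cycArc i j
ptWeight u₁ u₂ v₁ v₂ (inj₂ i) (inj₁ j) = + 0
ptWeight u₁ u₂ v₁ v₂ (inj₁ i) (inj₂ j) =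
  if (i == u₁) ∧ (j == v₁) then - (+ 1) else
  if (i == u₂) ∧ (j == v₂) then - (+ 1) else
  if (i == u₁) ∧ (j == v₂) then + 1 else
  if (i == u₂) ∧ (j == v₁) then + 1 else + 0

-- The (0,1,-1)-matrix corresponding to Γ for the ordering w_k = σ k.
ptMatrix : ∀ {n p q} → (σ : Fin n → Vertex p q) →
           (u₁ u₂ : Fin p) → (v₁ v₂ : Fin q) → Matrix n
ptMatrix σ u₁ u₂ v₁ v₂ a b = ptWeight u₁ u₂ v₁ v₂ (σ a) (σ b)

-- d_P(x,y): length of the directed path from x to y along the m-cycle.
dP : (m : ℕ) → Fin m → Fin m → ℕ
dP m x y = if toℕ x ≤ᵇ toℕ y then toℕ y ∸ toℕ x else (m ℕ.+ toℕ y) ∸ toℕ x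

{-# OPTIONS --safe #-}
-- Order the vertices as the p-cycle followed by the q-cycle. Then the matrix is
-- A = [[C_p, B], [0, C_q]] with C_m the cyclic permutation matrix of the m-cycle and
-- B = (e_{u₂} − e_{u₁})(e_{v₁} − e_{v₂})ᵀ, so A^k = [[C_p^k, X_k], [0, C_q^k]] where each entry of
-- X_k sums B along the orbit of a pair (i, j) under simultaneous rotation of both cycles.
-- If gcd(p, q) divides d_P(v₁, v₂), Bézout gives a multiple d of p rotating v₁ to v₂; shifting the
-- orbit by d fixes the p-coordinate and turns the v₂-terms into the v₁-terms, so over a full period
-- pq they cancel and A^{pq} = I (symmetrically for u₁, u₂). Otherwise the orbit of (u₂, v₁) never
-- meets (u₁, v₁) or (u₂, v₂), the only −1 entries of B, so for every k ≥ 1 the corresponding entry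
-- of A^k is a sum of nonnegative terms starting with B(u₂, v₁) = 1, and A^k ≠ I.
module Submission where

open import Defs
open import Data.Nat as ℕ using (ℕ; zero; suc)
import Data.Nat.Properties as ℕ
open import Data.Nat.DivMod using (_%_; n%n≡0; m<n⇒m%n≡m)
open import Data.Nat.Divisibility using (_∣_; _∣?_; divides; ∣-trans; ∣m+n∣m⇒∣n; ∣m⇒∣m*n; m∣m*n; n∣m*n)
open import Data.Nat.GCD using (gcd; GCD; gcd-GCD; gcd[m,n]∣m; gcd[m,n]∣n; module Bézout)
open import Data.Fin using (Fin; toℕ; fromℕ<; _≟_; splitAt) renaming (zero to fzero; suc to fsuc)
open import Data.Fin.Properties using (toℕ-injective; toℕ-fromℕ<; toℕ<n; +↔⊎; splitAt-join; nonZeroIndex)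
open import Data.Sum using (_⊎_; inj₁; inj₂; map₁)
open import Data.Sum.Properties using (≡-dec)
open import Data.Product using (Σ; ∃; _×_; _,_)
open import Data.Bool using (Bool; true; false; T; if_then_else_)
open import Function using (_∘_; _⇔_; mk⇔; Bijection; _⤖_; _↔_; Inverse)
open import Function.Properties.Bijection using (⤖⇒↔)
open import Function.Construct.Composition using (_↔-∘_; _⇔-∘_)
open import Function.Construct.Symmetry using (↔-sym)
open import Relation.Nullary using (¬_; does; yes; no; contradiction)
open import Relation.Nullary.Decidable using (dec-true; dec-false; does-⇔)
open import Relation.Binary.Definitions using (DecidableEquality)
open import Relation.Binary.PropositionalEquality
open ≡-Reasoning

-- ℕ arithmetic is opened only inside this module: below, _+_, _*_ and _-_ are the integer operations.
module Rotation where

  open import Data.Nat using (_+_; _*_; _∸_; _≤ᵇ_; pred)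
  open import Data.Nat.Properties
    using (+-comm; +-suc; +-identityʳ; *-assoc; *-suc; +-cancelˡ-≡; m+[n∸m]≡n; ≤-trans; <⇒≤; m≤m+n; ≤ᵇ⇒≤)
  open import Data.Nat.DivMod using (_/_; m%n<n; m≡m%n+[m/n]*n; [m+kn]%n≡m%n; %-distribˡ-+; m%n%n≡m%n)
  open import Data.Nat.Tactic.RingSolver using (solve-∀)

  private variable m : ℕ

  next : Fin m → Fin m
  next {suc m} i = fromℕ< (m%n<n (suc (toℕ i)) (suc m))

  rotate : ℕ → Fin m → Fin m
  rotate zero    x = x
  rotate (suc k) x = rotate k (next x)

  toℕ-next : (i : Fin (suc m)) → toℕ (next i) ≡ suc (toℕ i) % suc m
  toℕ-next {m} i = toℕ-fromℕ< (m%n<n (suc (toℕ i)) (suc m))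

  rotate-+ : ∀ a b (x : Fin m) → rotate (a + b) x ≡ rotate b (rotate a x)
  rotate-+ zero    b x = refl
  rotate-+ (suc a) b x = rotate-+ a b (next x)

  toℕ-rotate : ∀ k (x : Fin (suc m)) → toℕ (rotate k x) ≡ (toℕ x + k) % suc m
  toℕ-rotate {m} zero x = sym (begin
    (toℕ x + 0) % suc m ≡⟨ cong (_% suc m) (+-identityʳ (toℕ x)) ⟩
    toℕ x % suc m       ≡⟨ m<n⇒m%n≡m (toℕ<n x) ⟩
    toℕ x               ∎)
  toℕ-rotate {m} (suc k) x = begin
    toℕ (rotate k (next x))              ≡⟨ toℕ-rotate k (next x) ⟩
    (toℕ (next x) + k) % M               ≡⟨ cong (λ n → (n + k) % M) (toℕ-next x) ⟩
    (suc (toℕ x) % M + k) % M            ≡⟨ %-distribˡ-+ (suc (toℕ x) % M) k M ⟩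
    (suc (toℕ x) % M % M + k % M) % M    ≡⟨ cong (λ n → (n + k % M) % M) (m%n%n≡m%n (suc (toℕ x)) M) ⟩
    (suc (toℕ x) % M + k % M) % M        ≡⟨ %-distribˡ-+ (suc (toℕ x)) k M ⟨
    (suc (toℕ x) + k) % M                ≡⟨ cong (_% M) (+-suc (toℕ x) k) ⟨
    (toℕ x + suc k) % M                  ∎
    where M = suc m

  rotate-periodic : ∀ s (x : Fin m) → rotate (s * m) x ≡ x
  rotate-periodic {suc m} s x = toℕ-injective (begin
    toℕ (rotate (s * suc m) x)    ≡⟨ toℕ-rotate (s * suc m) x ⟩
    (toℕ x + s * suc m) % suc m   ≡⟨ [m+kn]%n≡m%n (toℕ x) s (suc m) ⟩
    toℕ x % suc m                 ≡⟨ m<n⇒m%n≡m (toℕ<n x) ⟩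
    toℕ x                         ∎)

  rotate-∣ : ∀ {k} → m ∣ k → (x : Fin m) → rotate k x ≡ x
  rotate-∣ (divides s refl) = rotate-periodic s

  rotate-inverse : ∀ k {x y : Fin m} → rotate k x ≡ y → rotate (k * pred m) y ≡ x
  rotate-inverse {suc m} k {x} refl = begin
    rotate (k * m) (rotate k x)   ≡⟨ rotate-+ k (k * m) x ⟨
    rotate (k + k * m) x          ≡⟨ cong (λ n → rotate n x) (*-suc k m) ⟨
    rotate (k * suc m) x          ≡⟨ rotate-periodic k x ⟩
    x                             ∎

  rotate-injective : ∀ k {x y : Fin m} → rotate k x ≡ rotate k y → x ≡ y
  rotate-injective {m} k {x} {y} eq = begin
    x                                  ≡⟨ rotate-inverse k refl ⟨
    rotate (k * pred m) (rotate k x)   ≡⟨ cong (rotate (k * pred m)) eq ⟩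
    rotate (k * pred m) (rotate k y)   ≡⟨ rotate-inverse k refl ⟩
    y                                  ∎

  rotate-fixed⇒∣ : ∀ t {x : Fin m} → rotate t x ≡ x → m ∣ t
  rotate-fixed⇒∣ {suc m} t {x} eq = divides Q (+-cancelˡ-≡ (toℕ x) _ _ (begin
    toℕ x + t                     ≡⟨ m≡m%n+[m/n]*n (toℕ x + t) (suc m) ⟩
    (toℕ x + t) % suc m + Q * suc m  ≡⟨ cong (_+ Q * suc m) (trans (sym (toℕ-rotate t x)) (cong toℕ eq)) ⟩
    toℕ x + Q * suc m             ∎))
    where Q = (toℕ x + t) / suc m

  ∣-respects-rotate : ∀ {h} a b {x : Fin m} → h ∣ m → rotate a x ≡ rotate b x → h ∣ a → h ∣ b
  ∣-respects-rotate {m} a b {x} h∣m eq h∣a =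
    ∣m+n∣m⇒∣n (∣-trans h∣m (rotate-fixed⇒∣ (a * pred m + b) x↦x)) (∣m⇒∣m*n (pred m) h∣a)
    where
    x↦x : rotate (a * pred m + b) x ≡ x
    x↦x = begin
      rotate (a * pred m + b) x          ≡⟨ cong (λ n → rotate n x) (+-comm (a * pred m) b) ⟩
      rotate (b + a * pred m) x          ≡⟨ rotate-+ b (a * pred m) x ⟩
      rotate (a * pred m) (rotate b x)   ≡⟨ rotate-inverse a eq ⟩
      x                                  ∎

  toℕ+dP : (x y : Fin m) → ∃ λ e → toℕ x + dP m x y ≡ toℕ y + e * m
  toℕ+dP {m} x y with toℕ x ≤ᵇ toℕ y in x≤ᵇy
  ... | true  = 0 , trans (m+[n∸m]≡n (≤ᵇ⇒≤ (toℕ x) (toℕ y) (subst T (sym x≤ᵇy) _)))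
                          (sym (+-identityʳ (toℕ y)))
  ... | false = 1 , (begin
    toℕ x + (m + toℕ y ∸ toℕ x)   ≡⟨ m+[n∸m]≡n (≤-trans (<⇒≤ (toℕ<n x)) (m≤m+n m (toℕ y))) ⟩
    m + toℕ y                     ≡⟨ +-comm m (toℕ y) ⟩
    toℕ y + m                     ≡⟨ cong (toℕ y +_) (+-identityʳ m) ⟨
    toℕ y + 1 * m                 ∎)

  rotate-dP : (x y : Fin m) → rotate (dP m x y) x ≡ y
  rotate-dP {suc m} x y with e , eq ← toℕ+dP x y = toℕ-injective (begin
    toℕ (rotate (dP (suc m) x y) x)   ≡⟨ toℕ-rotate (dP (suc m) x y) x ⟩
    (toℕ x + dP (suc m) x y) % suc m  ≡⟨ cong (_% suc m) eq ⟩
    (toℕ y + e * suc m) % suc m       ≡⟨ [m+kn]%n≡m%n (toℕ y) e (suc m) ⟩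
    toℕ y % suc m                     ≡⟨ m<n⇒m%n≡m (toℕ<n y) ⟩
    toℕ y                             ∎)

  next-surjective : (y : Fin m) → ∃ λ c → next c ≡ y
  next-surjective {suc m} y = rotate m y , (begin
    next (rotate m y)     ≡⟨ rotate-+ m 1 y ⟨
    rotate (m + 1) y      ≡⟨ cong (λ n → rotate n y) (trans (+-comm m 1) (sym (+-identityʳ (suc m)))) ⟩
    rotate (1 * suc m) y  ≡⟨ rotate-periodic 1 y ⟩
    y                     ∎)

  rotate-multiple-reaches : ∀ {a g} {x y : Fin m} → GCD a m g → g ∣ dP m x y →
                            ∃ λ s → rotate (a * s) x ≡ y
  rotate-multiple-reaches {m} {a} {g} {x} {y} gcd-a-m (divides e d≡e*g) with Bézout.identity gcd-a-m
  ... | Bézout.+- i j g+jm≡ia = i * e , (begin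
    rotate (a * (i * e)) x               ≡⟨ cong (λ n → rotate n x) reach ⟩
    rotate (d + j * e * m) x             ≡⟨ rotate-+ d (j * e * m) x ⟩
    rotate (j * e * m) (rotate d x)      ≡⟨ cong (rotate (j * e * m)) (rotate-dP x y) ⟩
    rotate (j * e * m) y                 ≡⟨ rotate-periodic (j * e) y ⟩
    y                                    ∎)
    where
    d = dP m x y
    reach : a * (i * e) ≡ d + j * e * m
    reach = begin
      a * (i * e)         ≡⟨ regroup a i e ⟩
      i * a * e           ≡⟨ cong (_* e) g+jm≡ia ⟨
      (g + j * m) * e     ≡⟨ expand g j e m ⟩
      e * g + j * e * m   ≡⟨ cong (_+ j * e * m) d≡e*g ⟨
      d + j * e * m       ∎
      where
      regroup : ∀ a i e → a * (i * e) ≡ i * a * e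
      regroup = solve-∀
      expand : ∀ g j e m → (g + j * m) * e ≡ e * g + j * e * m
      expand = solve-∀
  ... | Bézout.-+ i j g+ia≡jm = i * e * pred m , (begin
    rotate (a * (i * e * pred m)) x    ≡⟨ cong (λ n → rotate n x) (*-assoc a (i * e) (pred m)) ⟨
    rotate (a * (i * e) * pred m) x    ≡⟨ rotate-inverse (a * (i * e)) y↦x ⟩
    y                                  ∎)
    where
    d = dP m x y
    reach : d + a * (i * e) ≡ j * e * m
    reach = begin
      d + a * (i * e)       ≡⟨ cong (_+ a * (i * e)) d≡e*g ⟩
      e * g + a * (i * e)   ≡⟨ collect e g a i ⟩
      (g + i * a) * e       ≡⟨ cong (_* e) g+ia≡jm ⟩
      j * m * e             ≡⟨ swap j m e ⟩
      j * e * m             ∎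
      where
      collect : ∀ e g a i → e * g + a * (i * e) ≡ (g + i * a) * e
      collect = solve-∀
      swap : ∀ j m e → j * m * e ≡ j * e * m
      swap = solve-∀
    y↦x : rotate (a * (i * e)) y ≡ x
    y↦x = begin
      rotate (a * (i * e)) y               ≡⟨ cong (rotate (a * (i * e))) (rotate-dP x y) ⟨
      rotate (a * (i * e)) (rotate d x)    ≡⟨ rotate-+ d (a * (i * e)) x ⟨
      rotate (d + a * (i * e)) x           ≡⟨ cong (λ n → rotate n x) reach ⟩
      rotate (j * e * m) x                 ≡⟨ rotate-periodic (j * e) x ⟩
      x                                    ∎

open Rotation

open import Data.Integer using (ℤ; +_; _+_; _-_; _*_; _≤_; _<_; +≤+; +<+)
open import Data.Integer.Properties
  using ( +-assoc; +-comm; +-identityˡ; +-identityʳ; +-inverseʳ; *-comm; *-identityʳ; *-zeroˡ; *-zeroʳ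
        ; +-mono-≤; +-mono-<-≤; <⇒≢; +-0-abelianGroup; +-0-commutativeMonoid; +-*-ring)
open import Algebra.Properties.AbelianGroup +-0-abelianGroup using (∙-cancelˡ)
open import Algebra.Properties.Ring +-*-ring using (x[y-z]≈xy-xz)
open import Algebra.Properties.CommutativeMonoid.Sum +-0-commutativeMonoid using (sum; ∑-permute)
open import Data.Integer.Tactic.RingSolver using (solve-∀)

private variable m n p q : ℕ

-- Kronecker delta and finite sums

𝟙 : Bool → ℤ
𝟙 b = if b then + 1 else + 0

δ : Fin n → Fin n → ℤ
δ i j = 𝟙 (does (i ≟ j))

δ-refl : (i : Fin n) → δ i i ≡ + 1
δ-refl i = cong 𝟙 (dec-true (i ≟ i) refl)

δ-≢ : {i j : Fin n} → i ≢ j → δ i j ≡ + 0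
δ-≢ {i = i} {j} i≢j = cong 𝟙 (dec-false (i ≟ j) i≢j)

δ-rotate : ∀ k (x y : Fin m) → δ (rotate k x) (rotate k y) ≡ δ x y
δ-rotate k x y =
  cong 𝟙 (does-⇔ (mk⇔ (rotate-injective k) (cong (rotate k))) (rotate k x ≟ rotate k y) (x ≟ y))

sumℤ-cong : {f g : Fin n → ℤ} → (∀ l → f l ≡ g l) → sumℤ f ≡ sumℤ g
sumℤ-cong {zero}  f≗g = refl
sumℤ-cong {suc n} f≗g = cong₂ _+_ (f≗g fzero) (sumℤ-cong (f≗g ∘ fsuc))

sumℤ-zero : {f : Fin n → ℤ} → (∀ l → f l ≡ + 0) → sumℤ f ≡ + 0
sumℤ-zero {zero}  f≗0 = refl
sumℤ-zero {suc n} f≗0 = cong₂ _+_ (f≗0 fzero) (sumℤ-zero (f≗0 ∘ fsuc))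

sumℤ-δ : (h : Fin n → ℤ) (c : Fin n) → sumℤ (λ l → h l * δ l c) ≡ h c
sumℤ-δ {suc n} h fzero = begin
  h fzero * + 1 + sumℤ (λ l → h (fsuc l) * + 0)
    ≡⟨ cong₂ _+_ (*-identityʳ (h fzero)) (sumℤ-zero (*-zeroʳ ∘ h ∘ fsuc)) ⟩
  h fzero + + 0
    ≡⟨ +-identityʳ (h fzero) ⟩
  h fzero
    ∎
sumℤ-δ {suc n} h (fsuc c) = begin
  h fzero * + 0 + sumℤ (λ l → h (fsuc l) * δ l c)
    ≡⟨ cong₂ _+_ (*-zeroʳ (h fzero)) (sumℤ-δ (h ∘ fsuc) c) ⟩
  + 0 + h (fsuc c)
    ≡⟨ +-identityˡ (h (fsuc c)) ⟩
  h (fsuc c)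
    ∎

sumℤ≡sum : (f : Fin n → ℤ) → sumℤ f ≡ sum f
sumℤ≡sum {zero}  f = refl
sumℤ≡sum {suc n} f = cong (_+_ (f fzero)) (sumℤ≡sum (f ∘ fsuc))

sumBelow : ℕ → (ℕ → ℤ) → ℤ
sumBelow zero    F = + 0
sumBelow (suc N) F = F 0 + sumBelow N (F ∘ suc)

sumBelow-cong : ∀ N {F G : ℕ → ℤ} → (∀ t → F t ≡ G t) → sumBelow N F ≡ sumBelow N G
sumBelow-cong zero    F≗G = refl
sumBelow-cong (suc N) F≗G = cong₂ _+_ (F≗G 0) (sumBelow-cong N (F≗G ∘ suc))

sumBelow-sub : ∀ N (F G : ℕ → ℤ) → sumBelow N (λ t → F t - G t) ≡ sumBelow N F - sumBelow N G
sumBelow-sub zero    F G = refl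
sumBelow-sub (suc N) F G = begin
  (F 0 - G 0) + sumBelow N (λ t → F (suc t) - G (suc t))
    ≡⟨ cong (_+_ (F 0 - G 0)) (sumBelow-sub N (F ∘ suc) (G ∘ suc)) ⟩
  (F 0 - G 0) + (sumBelow N (F ∘ suc) - sumBelow N (G ∘ suc))
    ≡⟨ interchange (F 0) (G 0) _ _ ⟩
  (F 0 + sumBelow N (F ∘ suc)) - (G 0 + sumBelow N (G ∘ suc))
    ∎
  where
  interchange : ∀ a b c d → (a - b) + (c - d) ≡ (a + c) - (b + d)
  interchange = solve-∀

sumBelow-snoc : ∀ N (F : ℕ → ℤ) → sumBelow (suc N) F ≡ sumBelow N F + F N
sumBelow-snoc zero    F = trans (+-identityʳ (F 0)) (sym (+-identityˡ (F 0)))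
sumBelow-snoc (suc N) F = begin
  F 0 + sumBelow (suc N) (F ∘ suc)          ≡⟨ cong (_+_ (F 0)) (sumBelow-snoc N (F ∘ suc)) ⟩
  F 0 + (sumBelow N (F ∘ suc) + F (suc N))  ≡⟨ +-assoc (F 0) _ (F (suc N)) ⟨
  F 0 + sumBelow N (F ∘ suc) + F (suc N)    ∎

sumBelow-shift₁ : ∀ N (F : ℕ → ℤ) → F N ≡ F 0 → sumBelow N (F ∘ suc) ≡ sumBelow N F
sumBelow-shift₁ N F FN≡F0 = ∙-cancelˡ (F 0) _ _ (begin
  sumBelow (suc N) F      ≡⟨ sumBelow-snoc N F ⟩
  sumBelow N F + F N      ≡⟨ cong (_+_ (sumBelow N F)) FN≡F0 ⟩
  sumBelow N F + F 0      ≡⟨ +-comm (sumBelow N F) (F 0) ⟩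
  F 0 + sumBelow N F      ∎)

sumBelow-shift : ∀ N d (F : ℕ → ℤ) → (∀ t → F (t ℕ.+ N) ≡ F t) →
                 sumBelow N (λ t → F (t ℕ.+ d)) ≡ sumBelow N F
sumBelow-shift N zero    F periodic = sumBelow-cong N (cong F ∘ ℕ.+-identityʳ)
sumBelow-shift N (suc d) F periodic = begin
  sumBelow N (λ t → F (t ℕ.+ suc d))
    ≡⟨ sumBelow-cong N (λ t → cong F (ℕ.+-suc t d)) ⟩
  sumBelow N (λ t → F (suc t ℕ.+ d))
    ≡⟨ sumBelow-shift₁ N (λ t → F (t ℕ.+ d)) (trans (cong F (ℕ.+-comm N d)) (periodic d)) ⟩
  sumBelow N (λ t → F (t ℕ.+ d))
    ≡⟨ sumBelow-shift N d F periodic ⟩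
  sumBelow N F
    ∎

sumBelow-nonneg : ∀ N {F : ℕ → ℤ} → (∀ t → + 0 ≤ F t) → + 0 ≤ sumBelow N F
sumBelow-nonneg zero    F≥0 = +≤+ ℕ.z≤n
sumBelow-nonneg (suc N) F≥0 = +-mono-≤ (F≥0 0) (sumBelow-nonneg N (F≥0 ∘ suc))

sumBelow-pos : ∀ N {F : ℕ → ℤ} → (∀ t → + 0 ≤ F t) → + 0 < F 0 → + 0 < sumBelow (suc N) F
sumBelow-pos N F≥0 F0>0 = +-mono-<-≤ F0>0 (sumBelow-nonneg N (F≥0 ∘ suc))

-- Shifting by d turns the w₂-terms into the w₁-terms, and a sum over a full period is shift-invariant.
sumBelow-δ-balance : ∀ N d (α : ℕ → ℤ) (j w₁ w₂ : Fin m) →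
  (∀ t → α (t ℕ.+ N) ≡ α t) → (∀ t → α (t ℕ.+ d) ≡ α t) →
  (∀ y → rotate N y ≡ y) → rotate d w₁ ≡ w₂ →
  sumBelow N (λ t → α t * (δ (rotate t j) w₁ - δ (rotate t j) w₂)) ≡ + 0
sumBelow-δ-balance N d α j w₁ w₂ αᴺ αᵈ fixᴺ w₁↦w₂ = begin
  sumBelow N (λ t → α t * (δ (rotate t j) w₁ - δ (rotate t j) w₂))
    ≡⟨ sumBelow-cong N (λ t → x[y-z]≈xy-xz (α t) _ _) ⟩
  sumBelow N (λ t → G₁ t - G₂ t)
    ≡⟨ sumBelow-sub N G₁ G₂ ⟩
  sumBelow N G₁ - sumBelow N G₂
    ≡⟨ cong (_- sumBelow N G₂) ΣG₁≡ΣG₂ ⟩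
  sumBelow N G₂ - sumBelow N G₂
    ≡⟨ +-inverseʳ (sumBelow N G₂) ⟩
  + 0
    ∎
  where
  G₁ G₂ : ℕ → ℤ
  G₁ t = α t * δ (rotate t j) w₁
  G₂ t = α t * δ (rotate t j) w₂
  G₂-shift : ∀ t → G₂ (t ℕ.+ d) ≡ G₁ t
  G₂-shift t = cong₂ _*_ (αᵈ t) (begin
    δ (rotate (t ℕ.+ d) j) w₂                ≡⟨ cong₂ δ (rotate-+ t d j) (sym w₁↦w₂) ⟩
    δ (rotate d (rotate t j)) (rotate d w₁)  ≡⟨ δ-rotate d (rotate t j) w₁ ⟩
    δ (rotate t j) w₁                        ∎)
  G₂-periodic : ∀ t → G₂ (t ℕ.+ N) ≡ G₂ t
  G₂-periodic t = cong₂ _*_ (αᴺ t) (cong (λ z → δ z w₂) (trans (rotate-+ t N j) (fixᴺ (rotate t j))))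
  ΣG₁≡ΣG₂ : sumBelow N G₁ ≡ sumBelow N G₂
  ΣG₁≡ΣG₂ = trans (sym (sumBelow-cong N G₂-shift)) (sumBelow-shift N d G₂ G₂-periodic)

orbit-periodic : ∀ {k} (f : Fin m → ℤ) (j : Fin m) → (∀ y → rotate k y ≡ y) →
                 ∀ t → f (rotate (t ℕ.+ k) j) ≡ f (rotate t j)
orbit-periodic {k = k} f j fixed t = cong f (trans (rotate-+ t k j) (fixed (rotate t j)))

VMatrix : ℕ → ℕ → Set
VMatrix p q = Vertex p q → Vertex p q → ℤ

sumᵥ : (Vertex p q → ℤ) → ℤ
sumᵥ F = sumℤ (F ∘ inj₁) + sumℤ (F ∘ inj₂)

sumᵥ-cong : {F G : Vertex p q → ℤ} → (∀ z → F z ≡ G z) → sumᵥ F ≡ sumᵥ G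
sumᵥ-cong F≗G = cong₂ _+_ (sumℤ-cong (F≗G ∘ inj₁)) (sumℤ-cong (F≗G ∘ inj₂))

sumℤ-splitAt : ∀ p (F : Vertex p q → ℤ) → sumℤ (F ∘ splitAt p) ≡ sumᵥ F
sumℤ-splitAt zero    F = sym (+-identityˡ _)
sumℤ-splitAt (suc p) F = trans (cong (_+_ (F (inj₁ fzero))) (sumℤ-splitAt p (F ∘ map₁ fsuc)))
                               (sym (+-assoc (F (inj₁ fzero)) _ _))

_⊗ᵥ_ : VMatrix p q → VMatrix p q → VMatrix p q
(A ⊗ᵥ B) x y = sumᵥ (λ z → A x z * B z y)

_≟ᵥ_ : DecidableEquality (Vertex p q)
_≟ᵥ_ = ≡-dec _≟_ _≟_

Iᵥ : VMatrix p q
Iᵥ x y = 𝟙 (does (x ≟ᵥ y))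

_^ᵥ_ : VMatrix p q → ℕ → VMatrix p q
A ^ᵥ zero  = Iᵥ
A ^ᵥ suc k = A ⊗ᵥ (A ^ᵥ k)

HasFiniteOrderᵥ : VMatrix p q → Set
HasFiniteOrderᵥ A = Σ ℕ λ k → 1 ℕ.≤ k × (∀ x y → (A ^ᵥ k) x y ≡ Iᵥ x y)

^ᵥ-cong : {A B : VMatrix p q} → (∀ x y → A x y ≡ B x y) → ∀ k x y → (A ^ᵥ k) x y ≡ (B ^ᵥ k) x y
^ᵥ-cong A≗B zero    x y = refl
^ᵥ-cong A≗B (suc k) x y = sumᵥ-cong (λ z → cong₂ _*_ (A≗B x z) (^ᵥ-cong A≗B k z y))

HasFiniteOrderᵥ-cong : {A B : VMatrix p q} → (∀ x y → A x y ≡ B x y) →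
                       HasFiniteOrderᵥ A ⇔ HasFiniteOrderᵥ B
HasFiniteOrderᵥ-cong A≗B = mk⇔
  (λ (k , k≥1 , A^k≡I) → k , k≥1 , λ x y → trans (sym (^ᵥ-cong A≗B k x y)) (A^k≡I x y))
  (λ (k , k≥1 , B^k≡I) → k , k≥1 , λ x y → trans (^ᵥ-cong A≗B k x y) (B^k≡I x y))

module _ (σ : Fin n ⤖ Vertex p q) where
  open Bijection σ using (to; injective; strictlySurjective)

  relabel : VMatrix p q → Matrix n
  relabel A a b = A (to a) (to b)

  sumℤ-relabel : (F : Vertex p q → ℤ) → sumℤ (F ∘ to) ≡ sumᵥ F
  sumℤ-relabel F = begin
    sumℤ (F ∘ to)                        ≡⟨ sumℤ-cong (λ c → cong F (sym (splitAt-join p q (to c)))) ⟩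
    sumℤ (F ∘ splitAt p ∘ Inverse.to π)  ≡⟨ sumℤ≡sum (F ∘ splitAt p ∘ Inverse.to π) ⟩
    sum (F ∘ splitAt p ∘ Inverse.to π)   ≡⟨ ∑-permute (F ∘ splitAt p) π ⟨
    sum (F ∘ splitAt p)                  ≡⟨ sumℤ≡sum (F ∘ splitAt p) ⟨
    sumℤ (F ∘ splitAt p)                 ≡⟨ sumℤ-splitAt p F ⟩
    sumᵥ F                               ∎
    where
    π : Fin n ↔ Fin (p ℕ.+ q)
    π = ↔-sym +↔⊎ ↔-∘ ⤖⇒↔ σ

  I-relabel : ∀ a b → I a b ≡ Iᵥ (to a) (to b)
  I-relabel a b = cong 𝟙 (does-⇔ (mk⇔ (cong to) injective) (a ≟ b) (to a ≟ᵥ to b))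

  ^ᴹ-relabel : ∀ (A : VMatrix p q) k a b → (relabel A ^ᴹ k) a b ≡ (A ^ᵥ k) (to a) (to b)
  ^ᴹ-relabel A zero    a b = I-relabel a b
  ^ᴹ-relabel A (suc k) a b = begin
    sumℤ (λ c → A (to a) (to c) * (relabel A ^ᴹ k) c b)
      ≡⟨ sumℤ-cong (λ c → cong (A (to a) (to c) *_) (^ᴹ-relabel A k c b)) ⟩
    sumℤ (λ c → A (to a) (to c) * (A ^ᵥ k) (to c) (to b))
      ≡⟨ sumℤ-relabel (λ z → A (to a) z * (A ^ᵥ k) z (to b)) ⟩
    (A ^ᵥ suc k) (to a) (to b)
      ∎

  HasFiniteOrder-relabel : (A : VMatrix p q) → HasFiniteOrder (relabel A) ⇔ HasFiniteOrderᵥ A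
  HasFiniteOrder-relabel A = mk⇔
    (λ (k , k≥1 , M^k≡I) → k , k≥1 , λ x y →
      let a , a↦x = strictlySurjective x
          b , b↦y = strictlySurjective y
      in subst₂ (λ x y → (A ^ᵥ k) x y ≡ Iᵥ x y) a↦x b↦y
           (trans (sym (^ᴹ-relabel A k a b)) (trans (M^k≡I a b) (I-relabel a b))))
    (λ (k , k≥1 , A^k≡I) → k , k≥1 , λ a b →
      trans (^ᴹ-relabel A k a b) (trans (A^k≡I (to a) (to b)) (sym (I-relabel a b))))

-- Powers of the block matrix [[C_p, B], [0, C_q]]

toℕ≡⇔ : {j k : Fin m} {n : ℕ} → toℕ k ≡ n → (toℕ j ≡ n) ⇔ (j ≡ k)
toℕ≡⇔ k≡n = mk⇔ (λ j≡n → toℕ-injective (trans j≡n (sym k≡n))) (λ { refl → k≡n })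

-- does (a ℕ.≟ b) computes to a ≡ᵇ b, the test written in cycArc.
cycArc≡δ : (i j : Fin m) → cycArc i j ≡ δ j (next i)
cycArc≡δ {suc m} i j with suc (toℕ i) ℕ.≡ᵇ suc m in i≡ᵇlast
... | true  = cong 𝟙 (does-⇔ (toℕ≡⇔ (begin
  toℕ (next i)              ≡⟨ toℕ-next i ⟩
  suc (toℕ i) % suc m       ≡⟨ cong (λ k → suc k % suc m) i≡m ⟩
  suc m % suc m             ≡⟨ n%n≡0 (suc m) ⟩
  0                         ∎)) (toℕ j ℕ.≟ 0) (j ≟ next i))
  where
  i≡m : toℕ i ≡ m
  i≡m = ℕ.≡ᵇ⇒≡ (toℕ i) m (subst T (sym i≡ᵇlast) _)
... | false =
  cong 𝟙 (does-⇔ (toℕ≡⇔ (trans (toℕ-next i) (m<n⇒m%n≡m (ℕ.s≤s i<m))))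
                 (toℕ j ℕ.≟ suc (toℕ i)) (j ≟ next i))
  where
  i<m : toℕ i ℕ.< m
  i<m = ℕ.≤∧≢⇒< (ℕ.s≤s⁻¹ (toℕ<n i)) (λ i≡m → subst T i≡ᵇlast (ℕ.≡⇒≡ᵇ (toℕ i) m i≡m))

sumℤ-cycArc : (i : Fin m) (h : Fin m → ℤ) → sumℤ (λ l → cycArc i l * h l) ≡ h (next i)
sumℤ-cycArc i h = trans (sumℤ-cong (λ l → trans (cong (_* h l) (cycArc≡δ i l)) (*-comm _ (h l))))
                        (sumℤ-δ h (next i))

cycBlock : (Fin p → Fin q → ℤ) → VMatrix p q
cycBlock B (inj₁ i) (inj₁ j) = cycArc i j
cycBlock B (inj₂ i) (inj₂ j) = cycArc i j
cycBlock B (inj₂ i) (inj₁ j) = + 0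
cycBlock B (inj₁ i) (inj₂ j) = B i j

cornerPow : (Fin p → Fin q → ℤ) → ℕ → Fin p → Fin q → ℤ
cornerPow B zero    i j = + 0
cornerPow B (suc k) i j = cornerPow B k (next i) j + sumℤ (λ l → B i l * δ (rotate k l) j)

cycBlockPow : (Fin p → Fin q → ℤ) → ℕ → VMatrix p q
cycBlockPow B k (inj₁ i) (inj₁ j) = δ (rotate k i) j
cycBlockPow B k (inj₂ i) (inj₂ j) = δ (rotate k i) j
cycBlockPow B k (inj₂ i) (inj₁ j) = + 0
cycBlockPow B k (inj₁ i) (inj₂ j) = cornerPow B k i j

cycBlockPow-suc : ∀ (B : Fin p → Fin q → ℤ) k x y →
                  sumᵥ (λ z → cycBlock B x z * cycBlockPow B k z y) ≡ cycBlockPow B (suc k) x y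
cycBlockPow-suc B k (inj₁ i) (inj₁ j) =
  trans (cong₂ _+_ (sumℤ-cycArc i _) (sumℤ-zero (*-zeroʳ ∘ B i))) (+-identityʳ _)
cycBlockPow-suc B k (inj₁ i) (inj₂ j) = cong (_+ _) (sumℤ-cycArc i _)
cycBlockPow-suc B k (inj₂ i) (inj₁ j) =
  cong₂ _+_ (sumℤ-zero (λ l → *-zeroˡ (δ (rotate k l) j))) (sumℤ-zero (*-zeroʳ ∘ cycArc i))
cycBlockPow-suc B k (inj₂ i) (inj₂ j) =
  trans (cong₂ _+_ (sumℤ-zero (λ l → *-zeroˡ (cornerPow B k l j))) (sumℤ-cycArc i _)) (+-identityˡ _)

cycBlock-^ᵥ : ∀ (B : Fin p → Fin q → ℤ) k x y → (cycBlock B ^ᵥ k) x y ≡ cycBlockPow B k x y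
cycBlock-^ᵥ B zero    (inj₁ i) (inj₁ j) = refl
cycBlock-^ᵥ B zero    (inj₁ i) (inj₂ j) = refl
cycBlock-^ᵥ B zero    (inj₂ i) (inj₁ j) = refl
cycBlock-^ᵥ B zero    (inj₂ i) (inj₂ j) = refl
cycBlock-^ᵥ B (suc k) x y =
  trans (sumᵥ-cong (λ z → cong (cycBlock B x z *_) (cycBlock-^ᵥ B k z y))) (cycBlockPow-suc B k x y)

cornerPow-rotate : ∀ (B : Fin p → Fin q → ℤ) k i c →
                   cornerPow B k i (rotate k c) ≡ sumBelow k (λ t → B (rotate t i) (rotate (suc t) c))
cornerPow-rotate B zero    i c = refl
cornerPow-rotate B (suc k) i c = begin
  cornerPow B k (next i) (rotate k (next c)) + sumℤ (λ l → B i l * δ (rotate k l) (rotate k (next c)))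
    ≡⟨ cong₂ _+_ (cornerPow-rotate B k (next i) (next c))
                 (trans (sumℤ-cong (λ l → cong (B i l *_) (δ-rotate k l (next c)))) (sumℤ-δ (B i) (next c))) ⟩
  sumBelow k (λ t → B (rotate (suc t) i) (rotate (suc (suc t)) c)) + B i (next c)
    ≡⟨ +-comm _ (B i (next c)) ⟩
  sumBelow (suc k) (λ t → B (rotate t i) (rotate (suc t) c))
    ∎

cycBlockPow-period : ∀ (B : Fin p → Fin q → ℤ) N → (∀ i → rotate N i ≡ i) → (∀ j → rotate N j ≡ j) →
                     (∀ i j → sumBelow N (λ t → B (rotate t i) (rotate t j)) ≡ + 0) →
                     ∀ x y → cycBlockPow B N x y ≡ Iᵥ x y
cycBlockPow-period B N fixᵖ fixᑫ orbits-vanish (inj₁ i) (inj₁ j) = cong (λ z → δ z j) (fixᵖ i)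
cycBlockPow-period B N fixᵖ fixᑫ orbits-vanish (inj₂ i) (inj₂ j) = cong (λ z → δ z j) (fixᑫ i)
cycBlockPow-period B N fixᵖ fixᑫ orbits-vanish (inj₂ i) (inj₁ j) = refl
cycBlockPow-period B N fixᵖ fixᑫ orbits-vanish (inj₁ i) (inj₂ j) = begin
  cornerPow B N i j                                       ≡⟨ cong (cornerPow B N i) (fixᑫ j) ⟨
  cornerPow B N i (rotate N j)                            ≡⟨ cornerPow-rotate B N i j ⟩
  sumBelow N (λ t → B (rotate t i) (rotate t (next j)))   ≡⟨ orbits-vanish i (next j) ⟩
  + 0                                                     ∎

-- The PT-graph of type 2(c)

ptCorner : (u₁ u₂ : Fin p) (v₁ v₂ : Fin q) → Fin p → Fin q → ℤ
ptCorner u₁ u₂ v₁ v₂ i j = ptWeight u₁ u₂ v₁ v₂ (inj₁ i) (inj₂ j)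

ptWeight≗cycBlock : (u₁ u₂ : Fin p) (v₁ v₂ : Fin q) →
                    ∀ x y → ptWeight u₁ u₂ v₁ v₂ x y ≡ cycBlock (ptCorner u₁ u₂ v₁ v₂) x y
ptWeight≗cycBlock u₁ u₂ v₁ v₂ (inj₁ i) (inj₁ j) = refl
ptWeight≗cycBlock u₁ u₂ v₁ v₂ (inj₁ i) (inj₂ j) = refl
ptWeight≗cycBlock u₁ u₂ v₁ v₂ (inj₂ i) (inj₁ j) = refl
ptWeight≗cycBlock u₁ u₂ v₁ v₂ (inj₂ i) (inj₂ j) = refl

module _ {u₁ u₂ : Fin p} {v₁ v₂ : Fin q} (u₁≢u₂ : u₁ ≢ u₂) (v₁≢v₂ : v₁ ≢ v₂) where

  private
    B : Fin p → Fin q → ℤ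
    B = ptCorner u₁ u₂ v₁ v₂

  ptCorner-factor : ∀ x y → B x y ≡ (δ x u₂ - δ x u₁) * (δ y v₁ - δ y v₂)
  ptCorner-factor x y with x ≟ u₁ | x ≟ u₂ | y ≟ v₁ | y ≟ v₂
  ... | yes refl | yes x≡u₂ | _     | _        = contradiction x≡u₂ u₁≢u₂
  ... | _     | _     | yes refl | yes y≡v₂    = contradiction y≡v₂ v₁≢v₂
  ... | yes _ | no _  | yes _ | no _  = refl
  ... | yes _ | no _  | no _  | yes _ = refl
  ... | yes _ | no _  | no _  | no _  = refl
  ... | no _  | yes _ | yes _ | no _  = refl
  ... | no _  | yes _ | no _  | yes _ = refl
  ... | no _  | yes _ | no _  | no _  = refl
  ... | no _  | no _  | yes _ | no _  = refl
  ... | no _  | no _  | no _  | yes _ = refl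
  ... | no _  | no _  | no _  | no _  = refl

  ptCorner-factor′ : ∀ x y → B x y ≡ (δ y v₂ - δ y v₁) * (δ x u₁ - δ x u₂)
  ptCorner-factor′ x y = trans (ptCorner-factor x y) (swap (δ x u₂) (δ x u₁) (δ y v₁) (δ y v₂))
    where
    swap : ∀ a b c d → (a - b) * (c - d) ≡ (d - c) * (b - a)
    swap = solve-∀

  ptCorner-nonneg : ∀ x y → ¬ (x ≡ u₁ × y ≡ v₁) → ¬ (x ≡ u₂ × y ≡ v₂) → + 0 ≤ B x y
  ptCorner-nonneg x y ¬u₁v₁ ¬u₂v₂ with x ≟ u₁ | x ≟ u₂ | y ≟ v₁ | y ≟ v₂
  ... | yes refl | yes x≡u₂ | _     | _        = contradiction x≡u₂ u₁≢u₂
  ... | _     | _     | yes refl | yes y≡v₂    = contradiction y≡v₂ v₁≢v₂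
  ... | yes x≡u₁ | _     | yes y≡v₁ | _        = contradiction (x≡u₁ , y≡v₁) ¬u₁v₁
  ... | _     | yes x≡u₂ | _     | yes y≡v₂    = contradiction (x≡u₂ , y≡v₂) ¬u₂v₂
  ... | yes _ | no _  | no _  | yes _ = +≤+ ℕ.z≤n
  ... | yes _ | no _  | no _  | no _  = +≤+ ℕ.z≤n
  ... | no _  | yes _ | yes _ | no _  = +≤+ ℕ.z≤n
  ... | no _  | yes _ | no _  | no _  = +≤+ ℕ.z≤n
  ... | no _  | no _  | yes _ | no _  = +≤+ ℕ.z≤n
  ... | no _  | no _  | no _  | yes _ = +≤+ ℕ.z≤n
  ... | no _  | no _  | no _  | no _  = +≤+ ℕ.z≤n

  ptCorner-u₂v₁ : B u₂ v₁ ≡ + 1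
  ptCorner-u₂v₁ = begin
    B u₂ v₁
      ≡⟨ ptCorner-factor u₂ v₁ ⟩
    (δ u₂ u₂ - δ u₂ u₁) * (δ v₁ v₁ - δ v₁ v₂)
      ≡⟨ cong₂ (λ a b → (δ u₂ u₂ - a) * (δ v₁ v₁ - b)) (δ-≢ (u₁≢u₂ ∘ sym)) (δ-≢ v₁≢v₂) ⟩
    (δ u₂ u₂ - + 0) * (δ v₁ v₁ - + 0)
      ≡⟨ cong₂ (λ a b → (a - + 0) * (b - + 0)) (δ-refl u₂) (δ-refl v₁) ⟩
    + 1
      ∎

  orbit-hits-u₁v₁⇒∣ : ∀ t → rotate t u₂ ≡ u₁ → rotate t v₁ ≡ v₁ → gcd p q ∣ dP p u₁ u₂
  orbit-hits-u₁v₁⇒∣ t u₂↦u₁ v₁↦v₁ =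
    ∣m+n∣m⇒∣n (∣-trans (gcd[m,n]∣m p q) (rotate-fixed⇒∣ (t ℕ.+ dP p u₁ u₂) u₂↦u₂))
              (∣-trans (gcd[m,n]∣n p q) (rotate-fixed⇒∣ t v₁↦v₁))
    where
    u₂↦u₂ : rotate (t ℕ.+ dP p u₁ u₂) u₂ ≡ u₂
    u₂↦u₂ = begin
      rotate (t ℕ.+ dP p u₁ u₂) u₂          ≡⟨ rotate-+ t (dP p u₁ u₂) u₂ ⟩
      rotate (dP p u₁ u₂) (rotate t u₂)   ≡⟨ cong (rotate (dP p u₁ u₂)) u₂↦u₁ ⟩
      rotate (dP p u₁ u₂) u₁              ≡⟨ rotate-dP u₁ u₂ ⟩
      u₂                                  ∎

  orbit-hits-u₂v₂⇒∣ : ∀ t → rotate t u₂ ≡ u₂ → rotate t v₁ ≡ v₂ → gcd p q ∣ dP q v₁ v₂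
  orbit-hits-u₂v₂⇒∣ t u₂↦u₂ v₁↦v₂ =
    ∣-respects-rotate t (dP q v₁ v₂) (gcd[m,n]∣n p q) (trans v₁↦v₂ (sym (rotate-dP v₁ v₂)))
                      (∣-trans (gcd[m,n]∣m p q) (rotate-fixed⇒∣ t u₂↦u₂))

  orbit-nonneg : ¬ gcd p q ∣ dP p u₁ u₂ → ¬ gcd p q ∣ dP q v₁ v₂ →
                 ∀ t → + 0 ≤ B (rotate t u₂) (rotate t v₁)
  orbit-nonneg ∤u ∤v t = ptCorner-nonneg _ _
    (λ (u₂↦u₁ , v₁↦v₁) → ∤u (orbit-hits-u₁v₁⇒∣ t u₂↦u₁ v₁↦v₁))
    (λ (u₂↦u₂ , v₁↦v₂) → ∤v (orbit-hits-u₂v₂⇒∣ t u₂↦u₂ v₁↦v₂))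

  finiteOrder⇒∣ : HasFiniteOrderᵥ (cycBlock B) → gcd p q ∣ dP p u₁ u₂ ⊎ gcd p q ∣ dP q v₁ v₂
  finiteOrder⇒∣ (zero  , () , _)
  finiteOrder⇒∣ (suc k , _ , B^k≡I) with gcd p q ∣? dP p u₁ u₂ | gcd p q ∣? dP q v₁ v₂
  ... | yes ∣u | _      = inj₁ ∣u
  ... | no _   | yes ∣v = inj₂ ∣v
  ... | no ∤u  | no ∤v  with c , c↦v₁ ← next-surjective v₁ =
    contradiction (B^k≡I (inj₁ u₂) (inj₂ (rotate (suc k) c))) (≢-sym (<⇒≢ corner>0))
    where
    corner>0 : + 0 < (cycBlock B ^ᵥ suc k) (inj₁ u₂) (inj₂ (rotate (suc k) c))
    corner>0 = subst (+ 0 <_) (sym (trans (cycBlock-^ᵥ B (suc k) (inj₁ u₂) (inj₂ (rotate (suc k) c)))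
                                          (cornerPow-rotate B (suc k) u₂ c)))
      (subst (λ v → + 0 < sumBelow (suc k) (λ t → B (rotate t u₂) (rotate t v))) (sym c↦v₁)
        (sumBelow-pos k (orbit-nonneg ∤u ∤v) (subst (+ 0 <_) (sym ptCorner-u₂v₁) (+<+ ℕ.z<s))))

  ∣⇒orbits-vanish : gcd p q ∣ dP p u₁ u₂ ⊎ gcd p q ∣ dP q v₁ v₂ →
                    ∀ i j → sumBelow (p ℕ.* q) (λ t → B (rotate t i) (rotate t j)) ≡ + 0
  ∣⇒orbits-vanish (inj₁ ∣u) i j with s , u₁↦u₂ ← rotate-multiple-reaches (GCD.sym (gcd-GCD p q)) ∣u =
    trans (sumBelow-cong (p ℕ.* q) (λ t → ptCorner-factor′ (rotate t i) (rotate t j)))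
          (sumBelow-δ-balance (p ℕ.* q) (q ℕ.* s) (λ t → δ (rotate t j) v₂ - δ (rotate t j) v₁) i u₁ u₂
            (orbit-periodic (λ y → δ y v₂ - δ y v₁) j (rotate-∣ (n∣m*n p)))
            (orbit-periodic (λ y → δ y v₂ - δ y v₁) j (rotate-∣ (m∣m*n s)))
            (rotate-∣ (m∣m*n q)) u₁↦u₂)
  ∣⇒orbits-vanish (inj₂ ∣v) i j with s , v₁↦v₂ ← rotate-multiple-reaches (gcd-GCD p q) ∣v =
    trans (sumBelow-cong (p ℕ.* q) (λ t → ptCorner-factor (rotate t i) (rotate t j)))
          (sumBelow-δ-balance (p ℕ.* q) (p ℕ.* s) (λ t → δ (rotate t i) u₂ - δ (rotate t i) u₁) j v₁ v₂
            (orbit-periodic (λ x → δ x u₂ - δ x u₁) i (rotate-∣ (m∣m*n q)))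
            (orbit-periodic (λ x → δ x u₂ - δ x u₁) i (rotate-∣ (m∣m*n s)))
            (rotate-∣ (n∣m*n p)) v₁↦v₂)

  ∣⇒finiteOrder : gcd p q ∣ dP p u₁ u₂ ⊎ gcd p q ∣ dP q v₁ v₂ → HasFiniteOrderᵥ (cycBlock B)
  ∣⇒finiteOrder ∣ = p ℕ.* q , pq≥1 , λ x y →
    trans (cycBlock-^ᵥ B (p ℕ.* q) x y)
          (cycBlockPow-period B (p ℕ.* q) (rotate-∣ (m∣m*n q)) (rotate-∣ (n∣m*n p)) (∣⇒orbits-vanish ∣) x y)
    where
    pq≥1 : 1 ℕ.≤ p ℕ.* q
    pq≥1 = ℕ.>-nonZero⁻¹ (p ℕ.* q) {{ℕ.m*n≢0 p q {{nonZeroIndex u₁}} {{nonZeroIndex v₁}}}}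

theorem4p6 : (p q n : ℕ) (u₁ u₂ : Fin p) (v₁ v₂ : Fin q) →
    ¬ (u₁ ≡ u₂) → ¬ (v₁ ≡ v₂) →
    (σ : Fin n ⤖ Vertex p q) →
    HasFiniteOrder (ptMatrix (Bijection.to σ) u₁ u₂ v₁ v₂)
      ⇔ ((gcd p q ∣ dP p u₁ u₂) ⊎ (gcd p q ∣ dP q v₁ v₂))
theorem4p6 p q n u₁ u₂ v₁ v₂ u₁≢u₂ v₁≢v₂ σ =
  mk⇔ (finiteOrder⇒∣ u₁≢u₂ v₁≢v₂) (∣⇒finiteOrder u₁≢u₂ v₁≢v₂)
    ⇔-∘ (HasFiniteOrderᵥ-cong (ptWeight≗cycBlock u₁ u₂ v₁ v₂)
    ⇔-∘ HasFiniteOrder-relabel σ (ptWeight u₁ u₂ v₁ v₂))
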